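{- Let $P$ be a pairing of a finite set $S$ and let $s_1,s_2,s_3,s_4$ be four distinct elements of $S$. Then $\left(P_{\{s_1,s_2\}}\right)_{\{s_3,s_4\}}=\left(P_{\{s_3,s_4\}}\right)_{\{s_1,s_2\}}$.
   Context: A pairing of a finite set $S$ is a partition of $S$ into $2$-element subsets; if $\{s,t\}$ is one of its pairs, $t$ is called the partner of $s$. For a pairing $P$ of $S$ and two distinct elements $s_1,s_2\in S$, the pairing $P_{\{s_1,s_2\}}$ of $S\setminus\{s_1,s_2\}$ is defined as follows: if $\{s_1,s_2\}\in P$, then $P_{\{s_1,s_2\}}=P\setminus\{\{s_1,s_2\}\}$; otherwise, letting $t_1,t_2$ be the partners of $s_1,s_2$ in $P$ (so $s_1,s_2,t_1,t_2$ are distinct), $P_{\{s_1,s_2\}}=\big(P\setminus\{\{s_1,t_1\},\{s_2,t_2\}\}\big)\cup\{\{t_1,t_2\}\}$. -}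

module Defs where

open import Data.Nat using (ℕ)
open import Data.Fin using (Fin)
open import Data.Fin.Subset using (Subset; _∈_)
open import Data.Product using (_×_; ∃; ∃-syntax)
open import Data.Sum using (_⊎_)
open import Relation.Nullary using (¬_)
open import Relation.Binary.PropositionalEquality using (_≡_; _≢_)

-- A set of unordered pairs of elements of Fin n, represented as a
-- (symmetric) relation: P x y  means  {x , y} ∈ P.
PairSet : ℕ → Set₁
PairSet n = Fin n → Fin n → Set

SamePair : ∀ {n} → Fin n → Fin n → Fin n → Fin n → Set
SamePair x y a b = (x ≡ a × y ≡ b) ⊎ (x ≡ b × y ≡ a)

record IsPairing {n : ℕ} (S : Subset n) (P : PairSet n) : Set where
  field
    symmetric  : ∀ {x y} → P x y → P y x
    two-elem   : ∀ {x y} → P x y → x ≢ y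
    within     : ∀ {x y} → P x y → x ∈ S × y ∈ S
    covers     : ∀ {s} → s ∈ S → ∃[ t ] P s t
    unique     : ∀ {s t t′} → P s t → P s t′ → t ≡ t′

-- The pairing P_{s1,s2} of S ∖ {s1,s2}:
--   * if {s1,s2} ∈ P : P ∖ {{s1,s2}};
--   * otherwise, with t1, t2 the partners of s1, s2:
--       (P ∖ {{s1,t1},{s2,t2}}) ∪ {{t1,t2}}.
reduce : ∀ {n} → PairSet n → Fin n → Fin n → PairSet n
reduce P s₁ s₂ x y =
    (P s₁ s₂ × P x y × ¬ SamePair x y s₁ s₂)
  ⊎ (¬ P s₁ s₂ ×
      (  (P x y
          × ¬ (∃[ t₁ ] (P s₁ t₁ × SamePair x y s₁ t₁))
          × ¬ (∃[ t₂ ] (P s₂ t₂ × SamePair x y s₂ t₂)))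
       ⊎ (∃[ t₁ ] ∃[ t₂ ] (P s₁ t₁ × P s₂ t₂ × SamePair x y t₁ t₂))))

_≐_ : ∀ {n} → PairSet n → PairSet n → Set
P ≐ Q = ∀ x y → (P x y → Q x y) × (Q x y → P x y)

-- Away from the removed elements, P_{a,b} is a contraction: x is paired with y
-- either directly or through the removed pair, i.e. P x y, or P x a and P b y,
-- or P x b and P a y.  Two successive contractions therefore pair x with y
-- exactly when x and y are joined by a path of P-pairs whose inner steps cross
-- the removed pairs {s₁,s₂}, {s₃,s₄}, each at most once and in either order, a
-- description symmetric in the two removed pairs.

module Submission where

open import Defs
open import Data.Nat using (ℕ)
open import Data.Fin using (Fin)
open import Data.Fin.Properties using (_≟_)
open import Data.Fin.Subset using (Subset; _∈_)
open import Data.Fin.Subset.Properties using (_∈?_)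
open import Data.Product using (_×_; _,_; proj₁; proj₂; swap)
open import Data.Sum using (inj₁; inj₂)
open import Data.Empty using (⊥-elim)
open import Relation.Nullary using (¬_; Dec; yes; no; ¬?)
open import Relation.Nullary.Decidable using (_×-dec_; _⊎-dec_; map′)
open import Relation.Binary.Definitions using (Decidable)
open import Relation.Binary.PropositionalEquality using (_≡_; refl; _≢_; ≢-sym)

private
  variable
    n : ℕ
    P Q : PairSet n
    a b c d x y : Fin n

≐-sym : P ≐ Q → Q ≐ P
≐-sym P≐Q x y = swap (P≐Q x y)

≐-trans : ∀ {R : PairSet n} → P ≐ Q → Q ≐ R → P ≐ R
≐-trans P≐Q Q≐R x y =
  (λ p → proj₁ (Q≐R x y) (proj₁ (P≐Q x y) p)) ,
  (λ r → proj₂ (P≐Q x y) (proj₂ (Q≐R x y) r))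

decidable-resp-≐ : P ≐ Q → Decidable Q → Decidable P
decidable-resp-≐ P≐Q Q? x y = map′ (proj₂ (P≐Q x y)) (proj₁ (P≐Q x y)) (Q? x y)

record IsMatching (P : PairSet n) : Set where
  field
    symmetric   : P x y → P y x
    functional  : P x b → P x c → b ≡ c
    irreflexive : ¬ P x x

open IsMatching

isMatching-resp-≐ : P ≐ Q → IsMatching Q → IsMatching P
isMatching-resp-≐ {P = P} {Q = Q} P≐Q M = record
  { symmetric   = λ p → from (symmetric M (to p))
  ; functional  = λ p q → functional M (to p) (to q)
  ; irreflexive = λ p → irreflexive M (to p)
  }
  where
  to : P x y → Q x y
  to = proj₁ (P≐Q _ _)
  from : Q x y → P x y
  from = proj₂ (P≐Q _ _)

IsPairing⇒IsMatching : ∀ {S : Subset n} → IsPairing S P → IsMatching P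
IsPairing⇒IsMatching pairing = record
  { symmetric   = IsPairing.symmetric pairing
  ; functional  = IsPairing.unique pairing
  ; irreflexive = λ p → IsPairing.two-elem pairing p refl
  }

-- Off S nothing is paired, and on S a pair is recognised by comparing with the partner.
IsPairing⇒decidable : ∀ {S : Subset n} → IsPairing S P → Decidable P
IsPairing⇒decidable {S = S} pairing x y with x ∈? S
... | no x∉S = no λ Pxy → x∉S (proj₁ (IsPairing.within pairing Pxy))
... | yes x∈S with IsPairing.covers pairing x∈S
...   | t , Pxt = map′ (λ { refl → Pxt }) (λ Pxy → IsPairing.unique pairing Pxy Pxt) (y ≟ t)

Avoids : Fin n → Fin n → Fin n → Set
Avoids a b x = x ≢ a × x ≢ b

data Joined (P : PairSet n) (a b x y : Fin n) : Set where
  direct   : P x y → Joined P a b x y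
  through  : P x a → P b y → Joined P a b x y
  through′ : P x b → P a y → Joined P a b x y

contract : PairSet n → Fin n → Fin n → PairSet n
contract P a b x y = Avoids a b x × Avoids a b y × Joined P a b x y

joined-map : (∀ {u v} → P u v → Q u v) → Joined P a b x y → Joined Q a b x y
joined-map f (direct p)     = direct (f p)
joined-map f (through p q)  = through (f p) (f q)
joined-map f (through′ p q) = through′ (f p) (f q)

contract-map : (∀ {u v} → P u v → Q u v) → contract P a b x y → contract Q a b x y
contract-map f (xab , yab , j) = xab , yab , joined-map f j

contract-cong : P ≐ Q → contract P a b ≐ contract Q a b
contract-cong P≐Q x y =
  contract-map (proj₁ (P≐Q _ _)) , contract-map (proj₂ (P≐Q _ _))

contract-swap : contract P a b x y → contract P b a x y
contract-swap (xab , yab , direct p)     = swap xab , swap yab , direct p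
contract-swap (xab , yab , through p q)  = swap xab , swap yab , through′ p q
contract-swap (xab , yab , through′ p q) = swap xab , swap yab , through p q

contract-decidable : Decidable P → Decidable (contract P a b)
contract-decidable {P = P} {a = a} {b = b} P? x y =
  avoids? x ×-dec avoids? y ×-dec joined?
  where
  avoids? : ∀ z → Dec (Avoids a b z)
  avoids? z = ¬? (z ≟ a) ×-dec ¬? (z ≟ b)
  joined? : Dec (Joined P a b x y)
  joined? = map′
    (λ { (inj₁ p) → direct p ; (inj₂ (inj₁ (p , q))) → through p q ; (inj₂ (inj₂ (p , q))) → through′ p q })
    (λ { (direct p) → inj₁ p ; (through p q) → inj₂ (inj₁ (p , q)) ; (through′ p q) → inj₂ (inj₂ (p , q)) })
    (P? x y ⊎-dec ((P? x a ×-dec P? b y) ⊎-dec (P? x b ×-dec P? a y)))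

contract-isMatching : IsMatching P → a ≢ b → IsMatching (contract P a b)
contract-isMatching {P = P} {a = a} {b = b} M a≢b = record
  { symmetric   = λ (xab , yab , j) → yab , xab , joined-symmetric j
  ; functional  = functional′
  ; irreflexive = irreflexive′
  }
  where
  joined-symmetric : Joined P a b x y → Joined P a b y x
  joined-symmetric (direct p)     = direct (symmetric M p)
  joined-symmetric (through p q)  = through′ (symmetric M q) (symmetric M p)
  joined-symmetric (through′ p q) = through (symmetric M q) (symmetric M p)

  functional′ : contract P a b x c → contract P a b x d → c ≡ d
  functional′ (_ , _ , direct p)     (_ , _ , direct q)     = functional M p q
  functional′ (_ , (c≢a , _) , direct p) (_ , _ , through q _)  = ⊥-elim (c≢a (functional M p q))
  functional′ (_ , (_ , c≢b) , direct p) (_ , _ , through′ q _) = ⊥-elim (c≢b (functional M p q))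
  functional′ (_ , _ , through q _)  (_ , (d≢a , _) , direct p) = ⊥-elim (d≢a (functional M p q))
  functional′ (_ , _ , through′ q _) (_ , (_ , d≢b) , direct p) = ⊥-elim (d≢b (functional M p q))
  functional′ (_ , _ , through _ p)  (_ , _ , through _ q)  = functional M p q
  functional′ (_ , _ , through′ _ p) (_ , _ , through′ _ q) = functional M p q
  functional′ (_ , _ , through p _)  (_ , _ , through′ q _) = ⊥-elim (a≢b (functional M p q))
  functional′ (_ , _ , through′ p _) (_ , _ , through q _)  = ⊥-elim (a≢b (functional M q p))

  irreflexive′ : ¬ contract P a b x x
  irreflexive′ (_ , _ , direct p)     = irreflexive M p
  irreflexive′ (_ , _ , through p q)  = a≢b (functional M p (symmetric M q))
  irreflexive′ (_ , _ , through′ p q) = a≢b (functional M (symmetric M q) p)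

reduce⇒contract : IsMatching P → reduce P a b x y → contract P a b x y
reduce⇒contract {P = P} {a = a} {b = b} {x = x} {y = y} M (inj₁ (Pab , Pxy , ¬ab)) =
  (x≢a , x≢b) , (y≢a , y≢b) , direct Pxy
  where
  x≢a : x ≢ a
  x≢a refl = ¬ab (inj₁ (refl , functional M Pxy Pab))
  x≢b : x ≢ b
  x≢b refl = ¬ab (inj₂ (refl , functional M Pxy (symmetric M Pab)))
  y≢a : y ≢ a
  y≢a refl = ¬ab (inj₂ (functional M (symmetric M Pxy) Pab , refl))
  y≢b : y ≢ b
  y≢b refl = ¬ab (inj₁ (functional M (symmetric M Pxy) (symmetric M Pab) , refl))
reduce⇒contract {P = P} {a = a} {b = b} {x = x} {y = y} M (inj₂ (_ , inj₁ (Pxy , ¬a , ¬b))) =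
  (x≢a , x≢b) , (y≢a , y≢b) , direct Pxy
  where
  x≢a : x ≢ a
  x≢a refl = ¬a (y , Pxy , inj₁ (refl , refl))
  x≢b : x ≢ b
  x≢b refl = ¬b (y , Pxy , inj₁ (refl , refl))
  y≢a : y ≢ a
  y≢a refl = ¬a (x , symmetric M Pxy , inj₂ (refl , refl))
  y≢b : y ≢ b
  y≢b refl = ¬b (x , symmetric M Pxy , inj₂ (refl , refl))
reduce⇒contract {P = P} {a = a} {b = b} M (inj₂ (¬Pab , inj₂ (t₁ , t₂ , Pat₁ , Pbt₂ , t₁t₂))) =
  oriented t₁t₂
  where
  t₁≢a : t₁ ≢ a
  t₁≢a refl = irreflexive M Pat₁
  t₁≢b : t₁ ≢ b
  t₁≢b refl = ¬Pab Pat₁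
  t₂≢a : t₂ ≢ a
  t₂≢a refl = ¬Pab (symmetric M Pbt₂)
  t₂≢b : t₂ ≢ b
  t₂≢b refl = irreflexive M Pbt₂
  oriented : SamePair x y t₁ t₂ → contract P a b x y
  oriented (inj₁ (refl , refl)) = (t₁≢a , t₁≢b) , (t₂≢a , t₂≢b) , through (symmetric M Pat₁) Pbt₂
  oriented (inj₂ (refl , refl)) = (t₂≢a , t₂≢b) , (t₁≢a , t₁≢b) , through′ (symmetric M Pbt₂) Pat₁

contract⇒reduce : IsMatching P → Dec (P a b) → contract P a b x y → reduce P a b x y
contract⇒reduce M (yes Pab) ((x≢a , x≢b) , _ , direct Pxy) =
  inj₁ (Pab , Pxy , λ { (inj₁ (x≡a , _)) → x≢a x≡a ; (inj₂ (x≡b , _)) → x≢b x≡b })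
contract⇒reduce M (yes Pab) ((_ , x≢b) , _ , through Pxa _) =
  ⊥-elim (x≢b (functional M (symmetric M Pxa) Pab))
contract⇒reduce M (yes Pab) (_ , (_ , y≢b) , through′ _ Pay) =
  ⊥-elim (y≢b (functional M Pay Pab))
contract⇒reduce M (no ¬Pab) ((x≢a , x≢b) , (y≢a , y≢b) , direct Pxy) =
  inj₂ (¬Pab , inj₁ (Pxy ,
    (λ { (_ , _ , inj₁ (x≡a , _)) → x≢a x≡a ; (_ , _ , inj₂ (_ , y≡a)) → y≢a y≡a }) ,
    (λ { (_ , _ , inj₁ (x≡b , _)) → x≢b x≡b ; (_ , _ , inj₂ (_ , y≡b)) → y≢b y≡b })))
contract⇒reduce {x = x} {y = y} M (no ¬Pab) (_ , _ , through Pxa Pby) =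
  inj₂ (¬Pab , inj₂ (x , y , symmetric M Pxa , Pby , inj₁ (refl , refl)))
contract⇒reduce {x = x} {y = y} M (no ¬Pab) (_ , _ , through′ Pxb Pay) =
  inj₂ (¬Pab , inj₂ (y , x , Pay , symmetric M Pxb , inj₂ (refl , refl)))

reduce≐contract : IsMatching P → Dec (P a b) → reduce P a b ≐ contract P a b
reduce≐contract M Pab? x y = reduce⇒contract M , contract⇒reduce M Pab?

reduce-reduce≐contract-contract : IsMatching P → Decidable P → a ≢ b →
  reduce (reduce P a b) c d ≐ contract (contract P a b) c d
reduce-reduce≐contract-contract {P = P} {a = a} {b = b} {c = c} {d = d} M P? a≢b =
  ≐-trans (reduce≐contract M₁ (P₁? c d)) (contract-cong P₁≐contract)
  where
  P₁≐contract : reduce P a b ≐ contract P a b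
  P₁≐contract = reduce≐contract M (P? a b)
  M₁ : IsMatching (reduce P a b)
  M₁ = isMatching-resp-≐ P₁≐contract (contract-isMatching M a≢b)
  P₁? : Decidable (reduce P a b)
  P₁? = decidable-resp-≐ P₁≐contract (contract-decidable P?)

contract-exchange-through : IsMatching P → c ≢ d →
  Avoids c d a → Avoids c d b → Avoids c d x → Avoids c d y →
  contract P a b x c → contract P a b d y → contract (contract P c d) a b x y
contract-exchange-through {P = P} {c = c} {d = d} {a = a} {b = b} {x = x} {y = y}
  M c≢d acd bcd xcd ycd (xab , _ , u) (_ , yab , v) =
  xab , yab , joined u v
  where
  joined : Joined P a b x c → Joined P a b d y → Joined (contract P c d) a b x y
  joined (direct Pxc)       (direct Pdy)       = direct (xcd , ycd , through Pxc Pdy)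
  joined (direct Pxc)       (through Pda Pby)  = through (xcd , acd , through Pxc Pda) (bcd , ycd , direct Pby)
  joined (direct Pxc)       (through′ Pdb Pay) = through′ (xcd , bcd , through Pxc Pdb) (acd , ycd , direct Pay)
  joined (through Pxa Pbc)  (direct Pdy)       = through (xcd , acd , direct Pxa) (bcd , ycd , through Pbc Pdy)
  joined (through′ Pxb Pac) (direct Pdy)       = through′ (xcd , bcd , direct Pxb) (acd , ycd , through Pac Pdy)
  joined (through _ Pbc)    (through _ Pby)    = ⊥-elim (proj₁ ycd (functional M Pby Pbc))
  joined (through _ Pbc)    (through′ Pdb _)   = ⊥-elim (c≢d (functional M Pbc (symmetric M Pdb)))
  joined (through′ _ Pac)   (through Pda _)    = ⊥-elim (c≢d (functional M Pac (symmetric M Pda)))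
  joined (through′ _ Pac)   (through′ _ Pay)   = ⊥-elim (proj₁ ycd (functional M Pay Pac))

contract-exchange : IsMatching P → c ≢ d → Avoids c d a → Avoids c d b →
  contract (contract P a b) c d x y → contract (contract P c d) a b x y
contract-exchange {P = P} {c = c} {d = d} {a = a} {b = b} {x = x} {y = y}
  M c≢d acd bcd (xcd , ycd , direct (xab , yab , j)) =
  xab , yab , lift j
  where
  lift : Joined P a b x y → Joined (contract P c d) a b x y
  lift (direct p)     = direct (xcd , ycd , direct p)
  lift (through p q)  = through (xcd , acd , direct p) (bcd , ycd , direct q)
  lift (through′ p q) = through′ (xcd , bcd , direct p) (acd , ycd , direct q)
contract-exchange M c≢d acd bcd (xcd , ycd , through Qxc Qdy) =
  contract-exchange-through M c≢d acd bcd xcd ycd Qxc Qdy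
contract-exchange M c≢d acd bcd (xcd , ycd , through′ Qxd Qcy) =
  contract-map contract-swap
    (contract-exchange-through M (≢-sym c≢d) (swap acd) (swap bcd) (swap xcd) (swap ycd) Qxd Qcy)

contract-comm : IsMatching P → a ≢ b → c ≢ d → Avoids c d a → Avoids c d b →
  contract (contract P a b) c d ≐ contract (contract P c d) a b
contract-comm M a≢b c≢d (a≢c , a≢d) (b≢c , b≢d) x y =
  contract-exchange M c≢d (a≢c , a≢d) (b≢c , b≢d) ,
  contract-exchange M a≢b (≢-sym a≢c , ≢-sym b≢c) (≢-sym a≢d , ≢-sym b≢d)

-- A pairing is decidable everywhere.
lemma3p3 : ∀ (n : ℕ) (S : Subset n) (P : PairSet n) → IsPairing S P →
    ∀ (s₁ s₂ s₃ s₄ : Fin n) → s₁ ∈ S → s₂ ∈ S → s₃ ∈ S → s₄ ∈ S →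
    s₁ ≢ s₂ → s₁ ≢ s₃ → s₁ ≢ s₄ → s₂ ≢ s₃ → s₂ ≢ s₄ → s₃ ≢ s₄ →
    reduce (reduce P s₁ s₂) s₃ s₄ ≐ reduce (reduce P s₃ s₄) s₁ s₂
lemma3p3 n S P pairing s₁ s₂ s₃ s₄ _ _ _ _ s₁≢s₂ s₁≢s₃ s₁≢s₄ s₂≢s₃ s₂≢s₄ s₃≢s₄ =
  ≐-trans (reduce-reduce≐contract-contract M P? s₁≢s₂)
    (≐-trans (contract-comm M s₁≢s₂ s₃≢s₄ (s₁≢s₃ , s₁≢s₄) (s₂≢s₃ , s₂≢s₄))
      (≐-sym (reduce-reduce≐contract-contract M P? s₃≢s₄)))
  where
  M : IsMatching P
  M = IsPairing⇒IsMatching pairing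
  P? : Decidable P
  P? = IsPairing⇒decidable pairing
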